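{- Let $i(n,l,k)$ ($n<\omega$, $0<l<\omega$, $k<l$) be the integers defined recursively by $i(0,l,k)=1$ and, for fixed $n$ and $l$, by recursion on $k<l$: $i(n+1,l,k)=\max\{2^{y(n+1,l,k)}\, i(n,l,k),\ 2^{x(n,l)}+i(n,l,k)\}$, where $x(n,l)=\prod_{k'<l}i(n,l,k')$ and $y(n+1,l,k)=\prod_{k'<k}i(n+1,l,k')$ (empty product $=1$). Let $A$ be a non-empty finite set, $l=2^{|A|}$, and let $\langle s_k:k<l\rangle$ enumerate all subsets of $A$ so that $k'<k$ implies $s_k\not\subseteq s_{k'}$. For $a\subseteq A$ let $D_a=\{k<l: s_k\subseteq a\}$. Then for each $n\in\omega$ and each sequence of sets $\langle F_k:k<l\rangle$ with $|F_k|=i(n,l,k)$ for all $k<l$, the pair $u=\langle\langle u_a:a\subseteq A\rangle,\langle\pi_{u,b,a}:a\subseteq b\subseteq A\rangle\rangle$ given by $u_a=\prod_{k\in D_a}F_k$ and $\pi_{u,b,a}(s)=s\restriction D_a$ is a creature acting on $A$ and $\mathrm{nor}(u)\geq n$.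
   Context: Creatures: for a non-empty finite set $A$, a creature acting on $A$ is a pair $u=\langle\langle u_a:a\subseteq A\rangle,\langle\pi_{u,b,a}:a\subseteq b\subseteq A\rangle\rangle$ where each $u_a$ is a non-empty finite set, each $\pi_{u,b,a}:u_b\to u_a$ is onto, and $\pi_{u,c,a}=\pi_{u,b,a}\circ\pi_{u,c,b}$ whenever $a\subseteq b\subseteq c\subseteq A$; $\mathrm{cre}(A)$ is the set of creatures acting on $A$. For $u\in\mathrm{cre}(A)$, $\Sigma(u)$ is the set of $v\in\mathrm{cre}(A)$ with $v_a\subseteq u_a$ for all $a\subseteq A$ and $\pi_{v,b,a}=\pi_{u,b,a}\restriction v_b$ for all $a\subseteq b\subseteq A$. Norm: define "$\mathrm{nor}(u)\geq n$" by induction on $n$: $\mathrm{nor}(u)\geq0$ always; $\mathrm{nor}(u)\geq n+1$ iff (a) for each $a\subseteq A$, whenever $u_a=u^0\cup u^1$ there are $v\in\Sigma(u)$ and $i\in\{0,1\}$ with $\mathrm{nor}(v)\geq n$ and $v_a\subseteq u^i$; and (b) for all $a,b\subseteq A$ with $b\not\subseteq a$ and every function $F:\mathcal{P}(u_a)\to u_b$ there is $v\in\Sigma(u)$ with $\mathrm{nor}(v)\geq n$ and $F''\mathcal{P}(v_a)\cap v_b=\emptyset$. Then $\mathrm{nor}(u)=\max\{n:\mathrm{nor}(u)\geq n\}$. -}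

module Defs where

open import Data.Nat using (ℕ; zero; suc; _*_; _+_; _^_; _⊔_)
open import Data.Fin using (Fin; zero; suc)
open import Data.Fin.Subset using (Subset; _⊆_)
open import Data.Fin.Subset.Properties using (_⊆?_; ⊆-trans)
open import Data.Vec using (Vec; []; _∷_; replicate; lookup)
open import Data.Bool using (Bool; true; false)
open import Data.Unit using (⊤; tt)
open import Data.Empty using (⊥-elim)
open import Data.Product using (Σ; ∃; _×_; _,_)
open import Data.Sum using (_⊎_)
open import Relation.Nullary using (¬_; Dec; yes; no)
open import Relation.Binary.PropositionalEquality using (_≡_)
open import Function.Bundles using (_↔_)

vprod : ∀ {l} → Vec ℕ l → ℕ
vprod []       = 1
vprod (x ∷ xs) = x * vprod xs

-- nextRow x prev p : given x = x(n,l), the row ⟨i(n,l,k)⟩ (remaining part)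
-- and p = product of the already computed entries i(n+1,l,k') (k'<k),
-- computes the remaining entries i(n+1,l,k).
nextRow : ∀ {l} → ℕ → Vec ℕ l → ℕ → Vec ℕ l
nextRow x []       p = []
nextRow x (r ∷ rs) p =
  let v = (2 ^ p * r) ⊔ (2 ^ x + r) in v ∷ nextRow x rs (p * v)

row : ℕ → (l : ℕ) → Vec ℕ l
row zero    l = replicate l 1
row (suc n) l = nextRow (vprod (row n l)) (row n l) 1

i : ℕ → (l : ℕ) → Fin l → ℕ
i n l k = lookup (row n l) k

Finite : Set → Set
Finite X = Σ ℕ λ N → X ↔ Fin N

record PreCreature (m : ℕ) : Set₁ where
  field
    U : Subset m → Set
    π : (b a : Subset m) → a ⊆ b → U b → U a

module _ {m : ℕ} (u : PreCreature m) where
  open PreCreature u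

  IsCreature : Set
  IsCreature =
      ((a : Subset m) → U a)
    × ((a : Subset m) → Finite (U a))
    × ((b a : Subset m) (p : a ⊆ b) (y : U a) →
          ∃ λ x → π b a p x ≡ y)
    × ((a b c : Subset m) (p : a ⊆ b) (q : b ⊆ c) (r : a ⊆ c) (x : U c) →
          π c a r x ≡ π b a p (π c b q x))

  -- Sub-creatures are given by (decidable) subsets v_a ⊆ u_a.
  Pred : Set
  Pred = (a : Subset m) → U a → Bool

  _⊑_ : Pred → Pred → Set
  W ⊑ V = (a : Subset m) (x : U a) → W a x ≡ true → V a x ≡ true

  -- v ∈ Σ(u): with π_v the restriction of π_u, v is a creature
  IsSub : Pred → Set
  IsSub V =
      ((a : Subset m) → ∃ λ x → V a x ≡ true)
    × ((b a : Subset m) (p : a ⊆ b) (x : U b) →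
          V b x ≡ true → V a (π b a p x) ≡ true)
    × ((b a : Subset m) (p : a ⊆ b) (y : U a) → V a y ≡ true →
          ∃ λ x → V b x ≡ true × π b a p x ≡ y)

  -- "nor(v) ≥ n" for a sub-creature v (given by V) of u;
  -- note Σ(v) = { w ∈ Σ(u) : w ⊑ v }.
  NorGe : ℕ → Pred → Set
  NorGe zero    V = ⊤
  NorGe (suc n) V =
      ((a : Subset m) (u0 u1 : U a → Bool) →
         ((x : U a) → V a x ≡ true → u0 x ≡ true ⊎ u1 x ≡ true) →
         Σ Pred λ W → IsSub W × W ⊑ V × NorGe n W ×
           (((x : U a) → W a x ≡ true → u0 x ≡ true)
            ⊎ ((x : U a) → W a x ≡ true → u1 x ≡ true)))
    × ((a b : Subset m) → ¬ (b ⊆ a) →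
         (F : (U a → Bool) → U b) →
         -- F is a function on subsets (extensional in its argument)
         ((S S' : U a → Bool) → ((x : U a) → S x ≡ S' x) → F S ≡ F S') →
         -- F : P(v_a) → v_b
         ((S : U a → Bool) → ((x : U a) → S x ≡ true → V a x ≡ true) →
            V b (F S) ≡ true) →
         Σ Pred λ W → IsSub W × W ⊑ V × NorGe n W ×
           ((S : U a → Bool) → ((x : U a) → S x ≡ true → W a x ≡ true) →
              W b (F S) ≡ false))

  NorAtLeast : ℕ → Set
  NorAtLeast n = NorGe n (λ _ _ → true)

Tuple : (l : ℕ) → (Fin l → Set) → Set
Tuple zero    T = ⊤
Tuple (suc l) T = T zero × Tuple l (λ k → T (suc k))

mapT : ∀ {l} {T T' : Fin l → Set} → ((k : Fin l) → T k → T' k) →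
       Tuple l T → Tuple l T'
mapT {zero}  f tt       = tt
mapT {suc l} f (x , xs) = f zero x , mapT (λ k → f (suc k)) xs

-- coordinate k of an element of u_a: F_k if k ∈ D_a, trivial otherwise
Coord : ∀ {P : Set} → Dec P → Set → Set
Coord (yes _) X = X
Coord (no _)  X = ⊤

restrictCoord : ∀ {P Q : Set} {X : Set} (dP : Dec P) (dQ : Dec Q) →
                (P → Q) → Coord dQ X → Coord dP X
restrictCoord (yes p) (yes q) f x = x
restrictCoord (yes p) (no ¬q) f x = ⊥-elim (¬q (f p))
restrictCoord (no _)  dQ      f x = tt

prodCreature : (m l : ℕ) → (Fin l → Subset m) → (Fin l → Set) → PreCreature m
prodCreature m l s F = record
  { U = λ a → Tuple l (λ k → Coord (s k ⊆? a) (F k))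
  ; π = λ b a p → mapT (λ k → restrictCoord (s k ⊆? a) (s k ⊆? b)
                                (λ q → ⊆-trans q p))
  }

-- Every sub-creature used is again a product: a "box" whose k-th factor is the image of an
-- injection from Fin N_k into F_k. A box with N_k = i(n+1,l,k) has norm ≥ n+1 because each
-- clause of the norm is met by thinning every factor down to i(n,l,k) points. For (a) this is a
-- product Ramsey argument run along the coordinates: the tail after coordinate k is coloured by
-- the whole column of colours above it, which is where the factor 2^{y(n+1,l,k)} comes from. For
-- (b), pick k with s_k = b, so k ∈ D_b ∖ D_a; a subset of the thinned v_a is determined by its
-- trace on at most x(n,l) index tuples, so F takes at most 2^{x(n,l)} values on such subsets, and
-- the summand 2^{x(n,l)} in i(n+1,l,k) leaves room to thin coordinate k away from all their k-th
-- entries.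

module Submission where

open import Defs
open import Data.Bool using (Bool; true; false)
open import Data.Empty using (⊥-elim)
open import Data.Fin using (Fin; zero; suc; _<_; toℕ; inject≤; fromℕ<; lift)
open import Data.Fin.Base using (finToFun; funToFin)
open import Data.Fin.Properties
  using (¬Fin0; suc-injective; lift-injective; inject≤-injective; injective⇒≤;
         toℕ-injective; toℕ<n; any?; 1↔⊤; 2↔Bool; *↔×; finToFun-funToFin; inj⇒≟)
  renaming (_≟_ to _≟ᶠ_)
open import Data.Fin.Subset using (Subset; _⊆_)
open import Data.Fin.Subset.Properties using (_⊆?_; ⊆-refl)
open import Data.Nat using (ℕ; zero; suc; _+_; _*_; _^_; _≤_; _⊔_; _≤?_; pred; NonZero)
open import Data.Nat.Properties
  using (_≟_; ≤-refl; ≤-reflexive; ≤-trans; +-identityʳ; +-suc; +-cancelˡ-≤; +-monoˡ-≤;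
         *-monoˡ-≤; ^-monoˡ-≤; ^-*-assoc; m^n≢0; m≤m⊔n; m≤n⊔m; m≤n+m; n≤0⇒n≡0;
         ≤∧≢⇒<; m<1+n⇒m≤n; <⇒≤; ≰⇒>; <⇒≤pred; suc-pred)
open import Data.Product using (Σ; ∃; ∃₂; _×_; _,_; proj₁; proj₂)
open import Data.Product.Function.NonDependent.Propositional using (_×-↔_)
open import Data.Sum using (_⊎_; inj₁; inj₂)
open import Data.Unit using (tt)
open import Data.Vec using (Vec; []; _∷_; lookup; tabulate)
open import Data.Vec.Properties using (tabulate∘lookup; lookup-replicate)
open import Function using (_∘_; id)
open import Function.Bundles using (_↔_; _↣_; Inverse; Injection; mk↣)
open import Function.Construct.Composition using (_↣-∘_)
open import Function.Definitions using (Injective)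
open import Function.Properties.Inverse using (↔-refl; ↔-sym; ↔-trans; ↔⇒↣)
open import Relation.Binary.Definitions using (DecidableEquality)
open import Relation.Binary.PropositionalEquality
open import Relation.Nullary using (¬_; Dec; yes; no; does)
open import Relation.Nullary.Decidable using (map′; dec-true; dec-false)
open import Relation.Unary using (Decidable)

record Selection {v : ℕ} (P : Fin v → Set) (r : ℕ) : Set where
  field
    index     : Fin r → Fin v
    injective : Injective _≡_ _≡_ index
    satisfies : ∀ t → P (index t)

  injection : Fin r ↣ Fin v
  injection = mk↣ injective

open Selection

module _ {v : ℕ} {P : Fin v → Set} where

  nothing : Selection P 0
  nothing = record { index = λ () ; injective = λ {t} → ⊥-elim (¬Fin0 t) ; satisfies = λ () }

  everything : (∀ j → P j) → Selection P v
  everything p = record { index = id ; injective = id ; satisfies = p }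

  take : ∀ {r r'} → r' ≤ r → Selection P r → Selection P r'
  take r'≤r S = record
    { index     = λ t → index S (inject≤ t r'≤r)
    ; injective = λ eq → inject≤-injective r'≤r r'≤r _ _ (injective S eq)
    ; satisfies = λ t → satisfies S (inject≤ t r'≤r)
    }

_∘ˢ_ : ∀ {v b r} {P Q : Fin v → Set} (S : Selection P b) → Selection (Q ∘ index S) r → Selection Q r
S ∘ˢ S' = record
  { index     = index S ∘ index S'
  ; injective = λ eq → injective S' (injective S eq)
  ; satisfies = satisfies S'
  }

module _ {v : ℕ} {P : Fin (suc v) → Set} where

  shift : ∀ {r} → Selection (P ∘ suc) r → Selection P r
  shift S = record
    { index     = suc ∘ index S
    ; injective = injective S ∘ suc-injective
    ; satisfies = satisfies S
    }

  cons : ∀ {r} → P zero → Selection (P ∘ suc) r → Selection P (suc r)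
  cons p S = record
    { index     = lift 1 (index S)
    ; injective = lift-injective (index S) (injective S) 1
    ; satisfies = λ { zero → p ; (suc t) → satisfies S t }
    }

partition : ∀ {v} {P : Fin v → Set} → Decidable P →
            ∃₂ λ a b → a + b ≡ v × Selection P a × Selection (¬_ ∘ P) b
partition {zero} P? = 0 , 0 , refl , nothing , nothing
partition {suc v} P? with partition (P? ∘ suc) | P? zero
... | a , b , a+b≡v , Ps , ¬Ps | yes p  = suc a , b , cong suc a+b≡v , cons p Ps , shift ¬Ps
... | a , b , a+b≡v , Ps , ¬Ps | no ¬p  =
  a , suc b , trans (+-suc a b) (cong suc a+b≡v) , shift Ps , cons ¬p ¬Ps

≤-remainder : ∀ {a b x y} → x + y ≤ a + b → a ≤ x → y ≤ b
≤-remainder {a} {b} {x} {y} le a≤x = +-cancelˡ-≤ x y b (≤-trans le (+-monoˡ-≤ b a≤x))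

monochromatic-selection : ∀ {v} C r (h : Fin v → ℕ) → (∀ j → h j ≤ C) → suc C * r ≤ v →
                          ∃ λ col → Selection (λ j → h j ≡ col) r
monochromatic-selection zero r h h≤0 r≤v =
  0 , take (subst (_≤ _) (+-identityʳ r) r≤v) (everything (λ j → n≤0⇒n≡0 (h≤0 j)))
monochromatic-selection (suc C) r h h≤C le with partition (λ j → h j ≟ suc C)
... | a , b , refl , top , rest with r ≤? a
...   | yes r≤a = suc C , take r≤a top
...   | no r≰a  =
  let col , S = monochromatic-selection C r (h ∘ index rest) below (≤-remainder le (<⇒≤ (≰⇒> r≰a)))
  in  col , rest ∘ˢ S
  where
    below : ∀ t → h (index rest t) ≤ C
    below t = m<1+n⇒m≤n (≤∧≢⇒< (h≤C _) (satisfies rest t))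

avoiding-selection : ∀ {X : Set} {f r v} → DecidableEquality X →
                     (e : Fin v ↣ X) (forbidden : Fin f → X) → f + r ≤ v →
                     Selection (λ j → ¬ ∃ λ w → forbidden w ≡ Injection.to e j) r
avoiding-selection _≟X_ e forbidden f+r≤v
  with partition (λ j → any? (λ w → forbidden w ≟X Injection.to e j))
... | a , b , refl , hit , miss = take (≤-remainder f+r≤v a≤f) miss
  where
    a≤f : a ≤ _
    a≤f = injective⇒≤ {f = proj₁ ∘ satisfies hit} λ {t} {t'} eq →
      injective hit (Injection.injective e (begin
        Injection.to e (index hit t) ≡⟨ sym (proj₂ (satisfies hit t)) ⟩
        forbidden (proj₁ (satisfies hit t)) ≡⟨ cong forbidden eq ⟩
        forbidden (proj₁ (satisfies hit t')) ≡⟨ proj₂ (satisfies hit t') ⟩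
        Injection.to e (index hit t') ∎))
      where open ≡-Reasoning

module _ {A : Set} {N : ℕ} (A↔Fin : A ↔ Fin N) where

  ∃?-finite : {P : A → Set} → Decidable P → Dec (∃ P)
  ∃?-finite {P} P? = map′ (λ (w , p) → from w , p)
                          (λ (x , p) → to x , subst P (sym (strictlyInverseʳ x)) p)
                          (any? (P? ∘ from))
    where open Inverse A↔Fin

  ≟-finite : DecidableEquality A
  ≟-finite = inj⇒≟ (↔⇒↣ A↔Fin)

  booleanPredicate : Fin (2 ^ N) → A → Bool
  booleanPredicate w x = Inverse.to 2↔Bool (finToFun w (Inverse.to A↔Fin x))

  booleanPredicate-complete : (T : A → Bool) → ∃ λ w → ∀ x → booleanPredicate w x ≡ T x
  booleanPredicate-complete T = funToFin code , λ x → begin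
      Inverse.to 2↔Bool (finToFun (funToFin code) (to x)) ≡⟨ cong (Inverse.to 2↔Bool) (finToFun-funToFin code (to x)) ⟩
      Inverse.to 2↔Bool (code (to x))                      ≡⟨ Inverse.strictlyInverseˡ 2↔Bool _ ⟩
      T (from (to x))                                      ≡⟨ cong T (strictlyInverseʳ x) ⟩
      T x                                                  ∎
    where
      open Inverse A↔Fin
      open ≡-Reasoning
      code : Fin N → Fin 2
      code = Inverse.from 2↔Bool ∘ T ∘ from

does-true : ∀ {A : Set} (a? : Dec A) → does a? ≡ true → A
does-true (yes a) _ = a

lookupT : ∀ {l} {T : Fin l → Set} → Tuple l T → (k : Fin l) → T k
lookupT {suc l}     (x , _)  zero    = x
lookupT {suc l} {T} (_ , xs) (suc k) = lookupT {l} {T ∘ suc} xs k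

tabulateT : ∀ {l} {T : Fin l → Set} → ((k : Fin l) → T k) → Tuple l T
tabulateT {zero}      f = tt
tabulateT {suc l} {T} f = f zero , tabulateT {l} {T ∘ suc} (f ∘ suc)

lookupT-tabulateT : ∀ {l} {T : Fin l → Set} (f : (k : Fin l) → T k) k →
                    lookupT {l} {T} (tabulateT f) k ≡ f k
lookupT-tabulateT {suc l}     f zero    = refl
lookupT-tabulateT {suc l} {T} f (suc k) = lookupT-tabulateT {l} {T ∘ suc} (f ∘ suc) k

tabulateT-lookupT : ∀ {l} {T : Fin l → Set} (xs : Tuple l T) → tabulateT {l} {T} (lookupT xs) ≡ xs
tabulateT-lookupT {zero}      tt       = refl
tabulateT-lookupT {suc l} {T} (x , xs) = cong (x ,_) (tabulateT-lookupT {l} {T ∘ suc} xs)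

tabulateT-cong : ∀ {l} {T : Fin l → Set} {f g : (k : Fin l) → T k} →
                 (∀ k → f k ≡ g k) → tabulateT {l} {T} f ≡ tabulateT g
tabulateT-cong {zero}      eq = refl
tabulateT-cong {suc l} {T} eq = cong₂ _,_ (eq zero) (tabulateT-cong {l} {T ∘ suc} (eq ∘ suc))

mapT-tabulateT : ∀ {l} {T T' : Fin l → Set} (f : (k : Fin l) → T k → T' k) (g : (k : Fin l) → T k) →
                 mapT f (tabulateT {l} {T} g) ≡ tabulateT (λ k → f k (g k))
mapT-tabulateT {zero}           f g = refl
mapT-tabulateT {suc l} {T} {T'} f g =
  cong (f zero (g zero) ,_) (mapT-tabulateT {l} {T ∘ suc} {T' ∘ suc} (f ∘ suc) (g ∘ suc))

lookupT-mapT : ∀ {l} {T T' : Fin l → Set} (f : (k : Fin l) → T k → T' k) (xs : Tuple l T) k →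
               lookupT {l} {T'} (mapT f xs) k ≡ f k (lookupT xs k)
lookupT-mapT {suc l}           f (x , xs) zero    = refl
lookupT-mapT {suc l} {T} {T'} f (x , xs) (suc k) = lookupT-mapT {l} {T ∘ suc} {T' ∘ suc} (f ∘ suc) xs k

Tuple-↔ : ∀ {l} {T : Fin l → Set} (N : Fin l → ℕ) → (∀ k → T k ↔ Fin (N k)) →
          Tuple l T ↔ Fin (vprod (tabulate N))
Tuple-↔ {zero}      N T↔ = ↔-sym 1↔⊤
Tuple-↔ {suc l} {T} N T↔ = ↔-trans (T↔ zero ×-↔ Tuple-↔ {l} {T ∘ suc} (N ∘ suc) (T↔ ∘ suc)) (↔-sym *↔×)

Tuple-finite : ∀ {l} {T : Fin l → Set} → (∀ k → Finite (T k)) → Finite (Tuple l T)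
Tuple-finite finite = _ , Tuple-↔ (proj₁ ∘ finite) (proj₂ ∘ finite)

module _ {P X : Set} where

  coord : (d : Dec P) → X → Coord d X
  coord (yes _) x = x
  coord (no _)  _ = tt

  coord-value : (d : Dec P) → P → Coord d X → X
  coord-value (yes _) _ c = c
  coord-value (no ¬p) p _ = ⊥-elim (¬p p)

  coord-value-coord : (d : Dec P) (p : P) (x : X) → coord-value d p (coord d x) ≡ x
  coord-value-coord (yes _) _ _ = refl
  coord-value-coord (no ¬p) p _ = ⊥-elim (¬p p)

  coord-cong : (d : Dec P) {x y : X} → (P → x ≡ y) → coord d x ≡ coord d y
  coord-cong (yes p) eq = eq p
  coord-cong (no _)  _  = refl

  coord-surjective : X → (d : Dec P) (c : Coord d X) → ∃ λ x → coord d x ≡ c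
  coord-surjective _ (yes _) c = c , refl
  coord-surjective x (no _)  _ = x , refl

  Coord-finite : (d : Dec P) → Finite X → Finite (Coord d X)
  Coord-finite (yes _) finite = finite
  Coord-finite (no _)  _      = 1 , ↔-sym 1↔⊤

restrictCoord-coord : ∀ {P Q X : Set} (dP : Dec P) (dQ : Dec Q) (P⇒Q : P → Q) (x : X) →
                      restrictCoord dP dQ P⇒Q (coord dQ x) ≡ coord dP x
restrictCoord-coord (yes p) (yes _) _   _ = refl
restrictCoord-coord (yes p) (no ¬q) P⇒Q _ = ⊥-elim (¬q (P⇒Q p))
restrictCoord-coord (no _)  _       _   _ = refl

nextRow-≥ : ∀ {l} x (rs : Vec ℕ l) p k → 2 ^ x + lookup rs k ≤ lookup (nextRow x rs p) k
nextRow-≥ x (r ∷ rs) p zero    = m≤n⊔m (2 ^ p * r) (2 ^ x + r)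
nextRow-≥ x (r ∷ rs) p (suc k) = nextRow-≥ x rs _ k

i-suc-≥ : ∀ n l k → 2 ^ vprod (row n l) + i n l k ≤ i (suc n) l k
i-suc-≥ n l = nextRow-≥ (vprod (row n l)) (row n l) 1

i-mono : ∀ n l k → i n l k ≤ i (suc n) l k
i-mono n l k = ≤-trans (m≤n+m _ _) (i-suc-≥ n l k)

i-positive : ∀ n l k → 1 ≤ i n l k
i-positive zero    l k = ≤-reflexive (sym (lookup-replicate k 1))
i-positive (suc n) l k = ≤-trans (i-positive n l k) (i-mono n l k)

Index : ∀ {l} → (Fin l → ℕ) → Set
Index {l} N = Tuple l (λ k → Fin (N k))

Index-↔ : ∀ {l} (rs : Vec ℕ l) → Index (lookup rs) ↔ Fin (vprod rs)
Index-↔ rs = subst (λ xs → Index (lookup rs) ↔ Fin (vprod xs)) (tabulate∘lookup rs)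
                   (Tuple-↔ (lookup rs) (λ _ → ↔-refl))

Thinning : ∀ {l} → (Fin l → ℕ) → (Fin l → ℕ) → Set
Thinning {l} N N' = (k : Fin l) → Fin (N k) ↣ Fin (N' k)

thin : ∀ {l} {N N' : Fin l → ℕ} → Thinning N N' → Index N → Index N'
thin {l} {N} {N'} g = mapT {l} {λ k → Fin (N k)} {λ k → Fin (N' k)} (λ k → Injection.to (g k))

product-ramsey : ∀ {l C} .{{_ : NonZero C}} x p (rs : Vec ℕ l) → Index (lookup rs) → C ≤ 2 ^ p →
         (c : Index (lookup (nextRow x rs p)) → Fin C) →
         Σ (Thinning (lookup rs) (lookup (nextRow x rs p))) λ g → ∀ j j' → c (thin g j) ≡ c (thin g j')
product-ramsey x p []       _         _      c = (λ ()) , λ _ _ → refl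
product-ramsey {C = C} x p (r ∷ rs) (_ , js₀) C≤2^p c = g , homogeneous
  where
    v = (2 ^ p * r) ⊔ (2 ^ x + r)
    open ≡-Reasoning

    -- There are at most (2 ^ p) ^ v = 2 ^ (p * v) columns of colours, the bound nextRow provides.
    columnColour : Index (lookup (nextRow x rs (p * v))) → Fin (C ^ v)
    columnColour js = funToFin (λ j → c (j , js))

    tail : Σ (Thinning (lookup rs) (lookup (nextRow x rs (p * v)))) λ g →
             ∀ j j' → columnColour (thin g j) ≡ columnColour (thin g j')
    tail = product-ramsey {{m^n≢0 C v}} x (p * v) rs js₀
             (≤-trans (^-monoˡ-≤ v C≤2^p) (≤-reflexive (^-*-assoc 2 p v))) columnColour

    headColour : Fin v → Fin C
    headColour j = c (j , thin (proj₁ tail) js₀)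

    c≡headColour : ∀ j js → c (j , thin (proj₁ tail) js) ≡ headColour j
    c≡headColour j js = begin
      c (j , thin (proj₁ tail) js)                      ≡⟨ finToFun-funToFin _ j ⟨
      finToFun (columnColour (thin (proj₁ tail) js)) j  ≡⟨ cong (λ w → finToFun w j) (proj₂ tail js js₀) ⟩
      finToFun (columnColour (thin (proj₁ tail) js₀)) j ≡⟨ finToFun-funToFin _ j ⟩
      headColour j                                      ∎

    head : ∃ λ col → Selection (λ j → toℕ (headColour j) ≡ col) r
    head = monochromatic-selection (pred C) r (toℕ ∘ headColour) (λ j → <⇒≤pred (toℕ<n (headColour j)))
             (subst (λ D → D * r ≤ v) (sym (suc-pred C)) (≤-trans (*-monoˡ-≤ r C≤2^p) (m≤m⊔n _ _)))

    g : Thinning (lookup (r ∷ rs)) (lookup (nextRow x (r ∷ rs) p))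
    g zero    = injection (proj₂ head)
    g (suc k) = proj₁ tail k

    homogeneous : ∀ j j' → c (thin g j) ≡ c (thin g j')
    homogeneous (t , js) (t' , js') = begin
      c (index H t , thin (proj₁ tail) js)   ≡⟨ c≡headColour _ js ⟩
      headColour (index H t)                 ≡⟨ toℕ-injective (trans (satisfies H t) (sym (satisfies H t'))) ⟩
      headColour (index H t')                ≡⟨ c≡headColour _ js' ⟨
      c (index H t' , thin (proj₁ tail) js') ∎
      where H = proj₂ head

module _ {M : ℕ} (u : PreCreature M) where

  NorGe-cong : ∀ n {V V' : Pred u} → (∀ a x → V a x ≡ V' a x) → NorGe u n V → NorGe u n V'
  NorGe-cong zero    _    _               = tt
  NorGe-cong (suc n) {V} {V'} V≗V' (clauseA , clauseB) =
    (λ a u0 u1 cover →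
       let W , sub , W⊑V , nor , mono = clauseA a u0 u1 (λ x x∈ → cover x (trans (sym (V≗V' a x)) x∈))
       in  W , sub , ⊑-resp W⊑V , nor , mono) ,
    (λ a b b⊈a Fn Fn-ext Fn-into →
       let W , sub , W⊑V , nor , avoid =
             clauseB a b b⊈a Fn Fn-ext (λ S S⊆ → trans (V≗V' b (Fn S))
                                                  (Fn-into S (λ x x∈ → trans (sym (V≗V' a x)) (S⊆ x x∈))))
       in  W , sub , ⊑-resp W⊑V , nor , avoid)
    where
      ⊑-resp : ∀ {W} → _⊑_ u W V → _⊑_ u W V'
      ⊑-resp W⊑V a x x∈ = trans (sym (V≗V' a x)) (W⊑V a x x∈)

module ProductCreature {M L : ℕ} (s : Fin L → Subset M) (F : Fin L → Set) where

  u : PreCreature M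
  u = prodCreature M L s F

  open PreCreature u

  embed : (a : Subset M) → ((k : Fin L) → F k) → U a
  embed a z = tabulateT (λ k → coord (s k ⊆? a) (z k))

  π-embed : ∀ b a (a⊆b : a ⊆ b) z → π b a a⊆b (embed b z) ≡ embed a z
  π-embed b a a⊆b z =
    trans (mapT-tabulateT _ _) (tabulateT-cong λ k → restrictCoord-coord (s k ⊆? a) (s k ⊆? b) _ (z k))

  embed-cong : ∀ a {z z' : (k : Fin L) → F k} → (∀ k → s k ⊆ a → z k ≡ z' k) → embed a z ≡ embed a z'
  embed-cong a eq = tabulateT-cong λ k → coord-cong (s k ⊆? a) (eq k)

  embed-surjective : ((k : Fin L) → F k) → ∀ a (y : U a) → ∃ λ z → embed a z ≡ y
  embed-surjective default a y =
    proj₁ ∘ preimage , trans (tabulateT-cong (proj₂ ∘ preimage)) (tabulateT-lookupT y)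
    where
      preimage : ∀ k → ∃ λ x → coord (s k ⊆? a) x ≡ lookupT y k
      preimage k = coord-surjective (default k) (s k ⊆? a) (lookupT y k)

  value-embed : ∀ a z k (sk⊆a : s k ⊆ a) → coord-value (s k ⊆? a) sk⊆a (lookupT (embed a z) k) ≡ z k
  value-embed a z k sk⊆a =
    trans (cong (coord-value (s k ⊆? a) sk⊆a) (lookupT-tabulateT _ k))
          (coord-value-coord (s k ⊆? a) sk⊆a (z k))

  U-finite : (∀ k → Finite (F k)) → ∀ a → Finite (U a)
  U-finite finite a = Tuple-finite λ k → Coord-finite (s k ⊆? a) (finite k)

  prodCreature-isCreature : ((k : Fin L) → F k) → (∀ k → Finite (F k)) → IsCreature u
  prodCreature-isCreature default finite = (λ a → embed a default) , U-finite finite , onto , composition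
    where
      onto : (b a : Subset M) (a⊆b : a ⊆ b) (y : U a) → ∃ λ x → π b a a⊆b x ≡ y
      onto b a a⊆b y with embed-surjective default a y
      ... | z , refl = embed b z , π-embed b a a⊆b z

      composition : (a b c : Subset M) (a⊆b : a ⊆ b) (b⊆c : b ⊆ c) (a⊆c : a ⊆ c) (x : U c) →
                    π c a a⊆c x ≡ π b a a⊆b (π c b b⊆c x)
      composition a b c a⊆b b⊆c a⊆c x with embed-surjective default c x
      ... | z , refl = begin
        π c a a⊆c (embed c z)              ≡⟨ π-embed c a a⊆c z ⟩
        embed a z                          ≡⟨ π-embed b a a⊆b z ⟨
        π b a a⊆b (embed b z)              ≡⟨ cong (π b a a⊆b) (π-embed c b b⊆c z) ⟨
        π b a a⊆b (π c b b⊆c (embed c z)) ∎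
        where open ≡-Reasoning

  module Boxes (finite : ∀ k → Finite (F k)) where

    _≟U_ : ∀ {a} → DecidableEquality (U a)
    _≟U_ {a} = ≟-finite (proj₂ (U-finite finite a))

    Family : (Fin L → ℕ) → Set
    Family N = (k : Fin L) → Fin (N k) ↣ F k

    point : ∀ {N} → Family N → Index N → (k : Fin L) → F k
    point e j k = Injection.to (e k) (lookupT j k)

    InBox : ∀ {N} → Family N → (a : Subset M) → U a → Set
    InBox e a y = ∃ λ j → embed a (point e j) ≡ y

    inBox? : ∀ {N} (e : Family N) a y → Dec (InBox e a y)
    inBox? {N} e a y = ∃?-finite (Tuple-↔ N (λ _ → ↔-refl)) (λ j → embed a (point e j) ≟U y)

    box : ∀ {N} → Family N → Pred u
    box e a y = does (inBox? e a y)

    box-isSub : ∀ {N} (e : Family N) → Index N → IsSub u (box e)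
    box-isSub e j = nonempty , closed , onto
      where
        nonempty : ∀ a → ∃ λ y → box e a y ≡ true
        nonempty a = embed a (point e j) , dec-true (inBox? e a _) (j , refl)

        closed : ∀ b a (a⊆b : a ⊆ b) x → box e b x ≡ true → box e a (π b a a⊆b x) ≡ true
        closed b a a⊆b x x∈ with does-true (inBox? e b x) x∈
        ... | j' , refl = dec-true (inBox? e a _) (j' , sym (π-embed b a a⊆b _))

        onto : ∀ b a (a⊆b : a ⊆ b) y → box e a y ≡ true → ∃ λ x → box e b x ≡ true × π b a a⊆b x ≡ y
        onto b a a⊆b y y∈ with does-true (inBox? e a y) y∈
        ... | j' , refl = embed b (point e j') , dec-true (inBox? e b _) (j' , refl) , π-embed b a a⊆b _

    box-full : ∀ {N} (e : Family N) → Index N → (∀ k (x : F k) → ∃ λ t → Injection.to (e k) t ≡ x) →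
               ∀ a y → box e a y ≡ true
    box-full e j₀ e-onto a y with embed-surjective (point e j₀) a y
    ... | z , refl = dec-true (inBox? e a _) (tabulateT (proj₁ ∘ preimage) , embed-cong a λ k _ →
                       trans (cong (Injection.to (e k)) (lookupT-tabulateT _ k)) (proj₂ (preimage k)))
      where
        preimage : ∀ k → ∃ λ t → Injection.to (e k) t ≡ z k
        preimage k = e-onto k (z k)

    _∘ᶠ_ : ∀ {N N'} → Family N' → Thinning N N' → Family N
    (e ∘ᶠ g) k = e k ↣-∘ g k

    embed-∘ᶠ : ∀ {N N'} (e : Family N') (g : Thinning N N') a j →
               embed a (point (e ∘ᶠ g) j) ≡ embed a (point e (thin g j))
    embed-∘ᶠ e g a j = embed-cong a λ k _ → cong (Injection.to (e k)) (sym (lookupT-mapT _ j k))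

    box-∘ᶠ-⊑ : ∀ {N N'} (e : Family N') (g : Thinning N N') → _⊑_ u (box (e ∘ᶠ g)) (box e)
    box-∘ᶠ-⊑ e g a y y∈ with does-true (inBox? (e ∘ᶠ g) a y) y∈
    ... | j , refl = dec-true (inBox? e a _) (thin g j , sym (embed-∘ᶠ e g a j))

    origin : ∀ n → Index (i n L)
    origin n = tabulateT (λ k → fromℕ< (i-positive n L k))

    homogeneous-thinning : ∀ n (e : Family (i (suc n) L)) a (colour : U a → Bool) →
      Σ (Thinning (i n L) (i (suc n) L)) λ g → ∃ λ c → ∀ y → InBox (e ∘ᶠ g) a y → colour y ≡ c
    homogeneous-thinning n e a colour = g , colourOf (thin g (origin n)) , monochrome
      where
        open Inverse 2↔Bool
        open ≡-Reasoning

        colourOf : Index (i (suc n) L) → Bool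
        colourOf J = colour (embed a (point e J))

        homogeneous : Σ (Thinning (i n L) (i (suc n) L)) λ g →
                      ∀ j j' → from (colourOf (thin g j)) ≡ from (colourOf (thin g j'))
        homogeneous = product-ramsey (vprod (row n L)) 1 (row n L) (origin n) ≤-refl (from ∘ colourOf)

        g : Thinning (i n L) (i (suc n) L)
        g = proj₁ homogeneous

        monochrome : ∀ y → InBox (e ∘ᶠ g) a y → colour y ≡ colourOf (thin g (origin n))
        monochrome _ (j , refl) = begin
          colour (embed a (point (e ∘ᶠ g) j))      ≡⟨ cong colour (embed-∘ᶠ e g a j) ⟩
          colourOf (thin g j)                      ≡⟨ strictlyInverseˡ _ ⟨
          to (from (colourOf (thin g j)))          ≡⟨ cong to (proj₂ homogeneous j (origin n)) ⟩
          to (from (colourOf (thin g (origin n)))) ≡⟨ strictlyInverseˡ _ ⟩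
          colourOf (thin g (origin n))             ∎

    module _ (n : ℕ) (e : Family (i (suc n) L)) {a b : Subset M}
             (k* : Fin L) (k*∈b : s k* ⊆ b) (k*∉a : ¬ s k* ⊆ a)
             (Fn : (U a → Bool) → U b) (Fn-ext : ∀ S S' → (∀ y → S y ≡ S' y) → Fn S ≡ Fn S') where

      private
        initial : Thinning (i n L) (i (suc n) L)
        initial k = mk↣ {to = λ t → inject≤ t (i-mono n L k)} λ {t} {t'} → inject≤-injective _ _ t t'

        e₀ : Family (i n L)
        e₀ = e ∘ᶠ initial

        spread : (Index (i n L) → Bool) → U a → Bool
        spread T y with inBox? e₀ a y
        ... | yes (j , _) = T j
        ... | no _        = false

        spread-cong : ∀ {T T'} → (∀ j → T j ≡ T' j) → ∀ y → spread T y ≡ spread T' y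
        spread-cong T≗T' y with inBox? e₀ a y
        ... | yes (j , _) = T≗T' j
        ... | no _        = refl

        spread-trace : (S : U a → Bool) → (∀ y → S y ≡ true → InBox e₀ a y) →
                       ∀ y → spread (S ∘ embed a ∘ point e₀) y ≡ S y
        spread-trace S S⊆ y with inBox? e₀ a y
        ... | yes (j , eq) = cong S eq
        ... | no y∉ with S y in Sy
        ...   | true  = ⊥-elim (y∉ (S⊆ y Sy))
        ...   | false = refl

        subsetOf : Fin (2 ^ vprod (row n L)) → Index (i n L) → Bool
        subsetOf = booleanPredicate (Index-↔ (row n L))

        Fn-determined : ∀ S → (∀ y → S y ≡ true → InBox e₀ a y) → ∃ λ w → Fn (spread (subsetOf w)) ≡ Fn S
        Fn-determined S S⊆ =
          let w , w≗S = booleanPredicate-complete (Index-↔ (row n L)) (S ∘ embed a ∘ point e₀)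
          in  w , Fn-ext _ _ λ y → trans (spread-cong w≗S y) (spread-trace S S⊆ y)

        valueAt : U b → F k*
        valueAt y = coord-value (s k* ⊆? b) k*∈b (lookupT y k*)

        forbidden : Fin (2 ^ vprod (row n L)) → F k*
        forbidden w = valueAt (Fn (spread (subsetOf w)))

        fresh : Selection (λ t → ¬ ∃ λ w → forbidden w ≡ Injection.to (e k*) t) (i n L k*)
        fresh = avoiding-selection (≟-finite (proj₂ (finite k*))) (e k*) forbidden (i-suc-≥ n L k*)

        g : Thinning (i n L) (i (suc n) L)
        g k with k ≟ᶠ k*
        ... | yes refl = injection fresh
        ... | no _     = initial k

        g-off : ∀ k → k ≢ k* → ∀ t → Injection.to (g k) t ≡ Injection.to (initial k) t
        g-off k k≢k* t with k ≟ᶠ k*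
        ... | yes k≡k* = ⊥-elim (k≢k* k≡k*)
        ... | no _     = refl

        g-at : ∀ t → ¬ ∃ λ w → forbidden w ≡ Injection.to (e k*) (Injection.to (g k*) t)
        g-at t with k* ≟ᶠ k*
        ... | yes refl  = satisfies fresh t
        ... | no k*≢k* = ⊥-elim (k*≢k* refl)

        InBox-initial : ∀ {y} → InBox (e ∘ᶠ g) a y → InBox e₀ a y
        InBox-initial (j , eq) = j , trans (embed-cong a λ k sk⊆a →
          cong (Injection.to (e k)) (sym (g-off k (λ { refl → k*∉a sk⊆a }) _))) eq

        avoids : ∀ S → (∀ y → S y ≡ true → InBox (e ∘ᶠ g) a y) → ¬ InBox (e ∘ᶠ g) b (Fn S)
        avoids S S⊆ (j , eq) with Fn-determined S (λ y → InBox-initial ∘ S⊆ y)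
        ... | w , Fn≡ = g-at (lookupT j k*) (w , (begin
          valueAt (Fn (spread (subsetOf w)))   ≡⟨ cong valueAt Fn≡ ⟩
          valueAt (Fn S)                       ≡⟨ cong valueAt eq ⟨
          valueAt (embed b (point (e ∘ᶠ g) j)) ≡⟨ value-embed b _ k* k*∈b ⟩
          point (e ∘ᶠ g) j k*                  ∎))
          where open ≡-Reasoning

      avoiding-thinning : Σ (Thinning (i n L) (i (suc n) L)) λ g →
        ∀ S → (∀ y → S y ≡ true → InBox (e ∘ᶠ g) a y) → ¬ InBox (e ∘ᶠ g) b (Fn S)
      avoiding-thinning = g , avoids

    box-nor : ((b : Subset M) → ∃ λ k → s k ≡ b) → ∀ n (e : Family (i n L)) → NorGe u n (box e)
    box-nor surj zero    e = tt
    box-nor surj (suc n) e = clauseA , clauseB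
      where
        refine : (g : Thinning (i n L) (i (suc n) L)) {Q : Pred u → Set} → Q (box (e ∘ᶠ g)) →
                 Σ (Pred u) λ W → IsSub u W × _⊑_ u W (box e) × NorGe u n W × Q W
        refine g q = box (e ∘ᶠ g) , box-isSub (e ∘ᶠ g) (origin n) , box-∘ᶠ-⊑ e g , box-nor surj n (e ∘ᶠ g) , q

        clauseA : (a : Subset M) (u0 u1 : U a → Bool) →
                  ((x : U a) → box e a x ≡ true → u0 x ≡ true ⊎ u1 x ≡ true) →
                  Σ (Pred u) λ W → IsSub u W × _⊑_ u W (box e) × NorGe u n W ×
                    (((x : U a) → W a x ≡ true → u0 x ≡ true) ⊎ ((x : U a) → W a x ≡ true → u1 x ≡ true))
        clauseA a u0 u1 cover with homogeneous-thinning n e a u0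
        ... | g , true  , mono = refine g (inj₁ λ y y∈ → mono y (does-true (inBox? (e ∘ᶠ g) a y) y∈))
        ... | g , false , mono = refine g (inj₂ λ y y∈ →
                in-u1 (mono y (does-true (inBox? (e ∘ᶠ g) a y) y∈)) (cover y (box-∘ᶠ-⊑ e g a y y∈)))
          where
            in-u1 : ∀ {y} → u0 y ≡ false → u0 y ≡ true ⊎ u1 y ≡ true → u1 y ≡ true
            in-u1 u0y≡false (inj₁ u0y≡true) with trans (sym u0y≡false) u0y≡true
            ... | ()
            in-u1 _ (inj₂ u1y≡true) = u1y≡true

        clauseB : (a b : Subset M) → ¬ (b ⊆ a) → (Fn : (U a → Bool) → U b) →
                  ((S S' : U a → Bool) → ((x : U a) → S x ≡ S' x) → Fn S ≡ Fn S') →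
                  ((S : U a → Bool) → ((x : U a) → S x ≡ true → box e a x ≡ true) → box e b (Fn S) ≡ true) →
                  Σ (Pred u) λ W → IsSub u W × _⊑_ u W (box e) × NorGe u n W ×
                    ((S : U a → Bool) → ((x : U a) → S x ≡ true → W a x ≡ true) → W b (Fn S) ≡ false)
        -- The thinning avoids Fn S whatever Fn does.
        clauseB a b b⊈a Fn Fn-ext _ with surj b
        ... | k* , refl with avoiding-thinning n e k* ⊆-refl b⊈a Fn Fn-ext
        ...   | g , avoids = refine g λ S S⊆ → dec-false (inBox? (e ∘ᶠ g) b _)
                  (avoids S λ y y∈ → does-true (inBox? (e ∘ᶠ g) a y) (S⊆ y y∈))

mainTheorem4 : (m : ℕ) →
    (s : Fin (2 ^ suc m) → Subset (suc m)) →
    Injective _≡_ _≡_ s →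
    ((a : Subset (suc m)) → ∃ λ k → s k ≡ a) →
    ((k' k : Fin (2 ^ suc m)) → k' < k → ¬ (s k ⊆ s k')) →
    (n : ℕ) (F : Fin (2 ^ suc m) → Set) →
    ((k : Fin (2 ^ suc m)) → F k ↔ Fin (i n (2 ^ suc m) k)) →
    IsCreature (prodCreature (suc m) (2 ^ suc m) s F)
      × NorAtLeast (prodCreature (suc m) (2 ^ suc m) s F) n
mainTheorem4 m s _ surj _ n F F↔ = prodCreature-isCreature (point e (origin n)) finite , norm
  where
    open ProductCreature s F
    L = 2 ^ suc m

    finite : ∀ k → Finite (F k)
    finite k = i n L k , F↔ k

    open Boxes finite

    e : Family (i n L)
    e k = ↔⇒↣ (↔-sym (F↔ k))

    e-onto : ∀ k (x : F k) → ∃ λ t → Injection.to (e k) t ≡ x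
    e-onto k x = Inverse.to (F↔ k) x , Inverse.strictlyInverseʳ (F↔ k) x

    norm : NorAtLeast u n
    norm = NorGe-cong u n (box-full e (origin n) e-onto) (box-nor surj n e)
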